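{- Let $n>1$, let $\sigma\in\mathrm{Sym}(\{1,\dots,2n\})$ be a $2n$-cycle and $\rho\in\mathrm{Sym}(\{1,\dots,2n\})$ a fixed-point-free involution such that $\rho\sigma$ has exactly $n+1$ cycles. Let $f$ be a fixed point of $\rho\sigma$ (so $\{f,\sigma(f)\}$ is an orbit of $\rho$). Define permutations $\hat\rho,\hat\sigma$ of $\{1,\dots,2n\}\setminus\{f,\sigma(f)\}$ by $\hat\rho(k)=\rho(k)$ and $\hat\sigma(k)=\sigma^3(k)$ if $\sigma(k)=f$, $\hat\sigma(k)=\sigma(k)$ otherwise. Then $\hat\rho\hat\sigma$ has exactly $n$ cycles.
   Context: Permutations are composed as maps: $(\rho\sigma)(x)=\rho(\sigma(x))$. Cycles of a permutation means its orbits, fixed points counted. -}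

module Defs where

open import Data.Nat using (ℕ; zero; suc)
open import Data.Fin using (Fin; toℕ; _≤_)
open import Data.Fin.Properties using (_≟_; _≤?_; all?)
open import Data.Fin.Permutation using (Permutation′; _⟨$⟩ʳ_)
open import Data.List using (length; filter; allFin)
open import Data.Product using (∃; _×_)
open import Relation.Nullary using (Dec; yes; no; ¬_)
open import Relation.Nullary.Decidable using (_×-dec_; ¬?)
open import Relation.Unary using (Pred; Decidable)
open import Relation.Binary.PropositionalEquality using (_≡_; _≢_)
open import Level using (0ℓ)
open import Data.Unit using (⊤; tt)

iter : {A : Set} → (A → A) → ℕ → A → A
iter g zero    x = x
iter g (suc k) x = g (iter g k x)

-- x is the least element (in the order of Fin N) of its orbit under g.
-- Orbits of a permutation of Fin N have at most N elements, so the
-- iterates g^k x, 0 ≤ k < N, exhaust the orbit.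
OrbitMin : {N : ℕ} → (Fin N → Fin N) → Fin N → Set
OrbitMin {N} g x = (k : Fin N) → x ≤ iter g (toℕ k) x

orbitMin? : {N : ℕ} (g : Fin N → Fin N) → Decidable (OrbitMin g)
orbitMin? g x = all? (λ k → x ≤? iter g (toℕ k) x)

-- Number of cycles (orbits, fixed points counted) of g restricted to the
-- subset S ⊆ Fin N (assumed g-invariant): counted via the orbit minima in S.
cyclesOn : {N : ℕ} (S : Pred (Fin N) 0ℓ) → Decidable S → (Fin N → Fin N) → ℕ
cyclesOn S S? g = length (filter (λ x → S? x ×-dec orbitMin? g x) (allFin _))

Everything : {N : ℕ} → Pred (Fin N) 0ℓ
Everything _ = ⊤

everything? : {N : ℕ} → Decidable (Everything {N})
everything? _ = yes tt

cycles : {N : ℕ} → (Fin N → Fin N) → ℕ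
cycles g = cyclesOn Everything everything? g

_∘ₚ_ : {N : ℕ} → Permutation′ N → Permutation′ N → Fin N → Fin N
(ρ ∘ₚ σ) x = ρ ⟨$⟩ʳ (σ ⟨$⟩ʳ x)

IsFullCycle : {N : ℕ} → Permutation′ N → Set
IsFullCycle σ = ∀ x y → ∃ λ k → iter (σ ⟨$⟩ʳ_) k x ≡ y

IsFixedPointFreeInvolution : {N : ℕ} → Permutation′ N → Set
IsFixedPointFreeInvolution ρ =
  (∀ x → ρ ⟨$⟩ʳ (ρ ⟨$⟩ʳ x) ≡ x) × (∀ x → ρ ⟨$⟩ʳ x ≢ x)

Rest : {N : ℕ} → Permutation′ N → Fin N → Pred (Fin N) 0ℓ
Rest σ f k = (k ≢ f) × (k ≢ σ ⟨$⟩ʳ f)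

rest? : {N : ℕ} (σ : Permutation′ N) (f : Fin N) → Decidable (Rest σ f)
rest? σ f k = ¬? (k ≟ f) ×-dec ¬? (k ≟ σ ⟨$⟩ʳ f)

σ̂ : {N : ℕ} → Permutation′ N → Fin N → Fin N → Fin N
σ̂ σ f k with σ ⟨$⟩ʳ k ≟ f
... | yes _ = σ ⟨$⟩ʳ (σ ⟨$⟩ʳ (σ ⟨$⟩ʳ k))
... | no  _ = σ ⟨$⟩ʳ k

ρ̂ : {N : ℕ} → Permutation′ N → Fin N → Fin N
ρ̂ ρ k = ρ ⟨$⟩ʳ k

-- Put τ = ρσ and s = σ(f). Then ρ(f) = s, and ρ̂σ̂ agrees with τ except that it jumps
-- over s, sending x to τ(τ(x)) when τ(x) = s. So away from s the cycles of ρ̂σ̂ are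
-- those of τ with s deleted from its cycle; that cycle does not vanish, since τ(s) = s
-- would make {f, σ(f)} an orbit of the 2n-cycle σ. Deleting the fixed point f as well
-- loses exactly one cycle, leaving n. Cycles are counted by their least elements; the
-- cycle of s keeps its representative unless that was s itself, in which case the
-- next least element of the cycle takes over.
module Submission where

open import Defs
open import Data.Nat using (ℕ; _<_; _*_; _+_)
open import Data.Fin using (Fin)
open import Data.Fin.Permutation using (Permutation′; _⟨$⟩ʳ_)
open import Relation.Binary.PropositionalEquality using (_≡_)

open import Data.Nat using (zero; suc; _≤_; _∸_; _<?_; z≤n; s≤s)
open import Data.Nat.Properties
  using (n<1+n; ≤-pred; ≮⇒≥; ≰⇒>; <⇒≤; ≤-<-trans; <-≤-trans; +-monoʳ-<; m∸n+n≡m; m+[n∸m]≡n; +-suc; +-comm; *-suc;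
         *-monoʳ-≤; suc-injective)
open import Data.Nat.Induction using (<-rec)
open import Data.Fin using (toℕ; fromℕ<) renaming (_≤_ to _≤ᶠ_; _<_ to _<ᶠ_)
import Data.Fin.Properties as Fin
import Data.Fin.Induction as Fin
open import Data.Fin.Patterns using (0F; 1F; 2F)
open import Induction.WellFounded as WF using ()
open import Data.List using (_∷_; length; filter; allFin)
open import Data.List.Properties using (filter-≐; filter-accept; filter-reject)
open import Data.List.Relation.Unary.All as All using ([]; _∷_)
open import Data.List.Relation.Unary.Any using (here; there)
open import Data.List.Membership.Propositional using (_∈_)
open import Data.List.Membership.Propositional.Properties using (∈-allFin)
open import Data.List.Relation.Unary.Unique.Propositional using (Unique)
open import Data.List.Relation.Unary.Unique.Propositional.Properties using (allFin⁺)
open import Data.List.Relation.Unary.AllPairs using (_∷_)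
open import Data.Product using (∃; ∃₂; _×_; _,_; proj₁; proj₂)
open import Data.Sum using (_⊎_; inj₁; inj₂)
open import Data.Empty using (⊥-elim)
open import Data.Unit using (tt)
open import Function using (_∘_)
open import Function.Bundles using (Injection)
open import Function.Definitions using (Injective)
open import Function.Properties.Inverse using (↔⇒↣)
open import Level using (0ℓ)
open import Relation.Nullary using (Dec; yes; no; ¬_)
open import Relation.Nullary.Decidable using (_×-dec_; ¬?; map′)
open import Relation.Unary using (Pred; Decidable; _≐_)
open import Relation.Binary.PropositionalEquality
  using (refl; sym; trans; cong; subst; _≢_; module ≡-Reasoning)

open ≡-Reasoning

private variable
  A : Set
  N : ℕ

-- Iteration and orbits

iter-+ : (h : A → A) (m k : ℕ) (x : A) → iter h (m + k) x ≡ iter h m (iter h k x)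
iter-+ h zero    k x = refl
iter-+ h (suc m) k x = cong h (iter-+ h m k x)

iter-*-periodic : (h : A → A) {x : A} (p : ℕ) → iter h p x ≡ x → ∀ q → iter h (q * p) x ≡ x
iter-*-periodic h     p hᵖx≡x zero    = refl
iter-*-periodic h {x} p hᵖx≡x (suc q) = begin
  iter h (p + q * p) x         ≡⟨ iter-+ h p (q * p) x ⟩
  iter h p (iter h (q * p) x)  ≡⟨ cong (iter h p) (iter-*-periodic h p hᵖx≡x q) ⟩
  iter h p x                   ≡⟨ hᵖx≡x ⟩
  x                            ∎

iter-fixed : (h : A → A) {x : A} → h x ≡ x → ∀ k → iter h k x ≡ x
iter-fixed h hx≡x zero    = refl
iter-fixed h hx≡x (suc k) = trans (cong h (iter-fixed h hx≡x k)) hx≡x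

iter-injective : {h : A → A} → Injective _≡_ _≡_ h → ∀ k → Injective _≡_ _≡_ (iter h k)
iter-injective h-inj zero    e = e
iter-injective h-inj (suc k) e = iter-injective h-inj k (h-inj e)

Reaches : (A → A) → A → A → Set
Reaches h x y = ∃ λ k → iter h k x ≡ y

Reaches-trans : (h : A → A) {x y z : A} → Reaches h x y → Reaches h y z → Reaches h x z
Reaches-trans h {x} (k , refl) (m , refl) = m + k , iter-+ h m k x

Reaches-step : (h : A → A) {x y z : A} → Reaches h x y → h y ≡ z → Reaches h x z
Reaches-step h (k , refl) hy≡z = suc k , hy≡z

iter-below-repeat : (h : A → A) (x : A) {i j : ℕ} → i < j → iter h i x ≡ iter h j x →
                    ∀ k → ∃ λ k′ → k′ < j × iter h k′ x ≡ iter h k x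
iter-below-repeat {A} h x {i} {j} i<j hⁱx≡hʲx = <-rec Below reduce
  where
  Below : ℕ → Set
  Below k = ∃ λ k′ → k′ < j × iter h k′ x ≡ iter h k x

  reduce : ∀ k → (∀ {k′} → k′ < k → Below k′) → Below k
  reduce k below with k <? j
  ... | yes k<j = k , k<j , refl
  ... | no  k≮j = let (k′ , k′<j , e) = below shorter in k′ , k′<j , trans e shift
    where
    j≤k : j ≤ k
    j≤k = ≮⇒≥ k≮j

    shorter : k ∸ j + i < k
    shorter = subst (k ∸ j + i <_) (m∸n+n≡m j≤k) (+-monoʳ-< (k ∸ j) i<j)

    shift : iter h (k ∸ j + i) x ≡ iter h k x
    shift = begin
      iter h (k ∸ j + i) x          ≡⟨ iter-+ h (k ∸ j) i x ⟩
      iter h (k ∸ j) (iter h i x)   ≡⟨ cong (iter h (k ∸ j)) hⁱx≡hʲx ⟩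
      iter h (k ∸ j) (iter h j x)   ≡⟨ iter-+ h (k ∸ j) j x ⟨
      iter h (k ∸ j + j) x          ≡⟨ cong (λ t → iter h t x) (m∸n+n≡m j≤k) ⟩
      iter h k x                    ∎

iter-repeats : (h : Fin N → Fin N) (x : Fin N) →
               ∃₂ λ i j → i < j × j ≤ N × iter h i x ≡ iter h j x
iter-repeats {N} h x =
  let (i , j , i<j , hⁱx≡hʲx) = Fin.pigeonhole (n<1+n N) (λ (i : Fin (suc N)) → iter h (toℕ i) x)
  in toℕ i , toℕ j , i<j , ≤-pred (Fin.toℕ<n j) , hⁱx≡hʲx

Reaches-bounded : (h : Fin N → Fin N) {x y : Fin N} → Reaches h x y →
                  ∃ λ (k : Fin N) → iter h (toℕ k) x ≡ y
Reaches-bounded h {x} (k , refl) =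
  let (i , j , i<j , j≤N , hⁱx≡hʲx) = iter-repeats h x
      (k′ , k′<j , hᵏ′x≡hᵏx)         = iter-below-repeat h x i<j hⁱx≡hʲx k
      k′<N = <-≤-trans k′<j j≤N
  in fromℕ< k′<N , trans (cong (λ t → iter h t x) (Fin.toℕ-fromℕ< k′<N)) hᵏ′x≡hᵏx

reaches? : (h : Fin N → Fin N) (x : Fin N) → Decidable (Reaches h x)
reaches? h x y = map′ (λ (k , e) → toℕ k , e) (Reaches-bounded h)
                      (Fin.any? λ k → iter h (toℕ k) x Fin.≟ y)

iter-period : {h : Fin N → Fin N} → Injective _≡_ _≡_ h → ∀ x → ∃ λ p → iter h (suc p) x ≡ x
iter-period {h = h} h-inj x =
  let (i , j , i<j , _ , hⁱx≡hʲx) = iter-repeats h x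
      p = j ∸ suc i
      j≡i+1+p : j ≡ i + suc p
      j≡i+1+p = sym (trans (+-suc i p) (m+[n∸m]≡n i<j))
  in p , sym (iter-injective h-inj i (begin
       iter h i x               ≡⟨ hⁱx≡hʲx ⟩
       iter h j x               ≡⟨ cong (λ t → iter h t x) j≡i+1+p ⟩
       iter h (i + suc p) x     ≡⟨ iter-+ h i (suc p) x ⟩
       iter h i (iter h (suc p) x) ∎))

Reaches-sym : {h : Fin N → Fin N} → Injective _≡_ _≡_ h → {x y : Fin N} →
              Reaches h x y → Reaches h y x
Reaches-sym {h = h} h-inj {x} (m , refl) =
  let (p , hᵖ⁺¹x≡x) = iter-period h-inj x
  in m * p , (begin
       iter h (m * p) (iter h m x)  ≡⟨ iter-+ h (m * p) m x ⟨
       iter h (m * p + m) x         ≡⟨ cong (λ t → iter h t x) (trans (+-comm (m * p) m) (sym (*-suc m p))) ⟩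
       iter h (m * suc p) x         ≡⟨ iter-*-periodic h (suc p) hᵖ⁺¹x≡x m ⟩
       x                            ∎)

OrbitMin⇒least : (h : Fin N → Fin N) {x y : Fin N} → OrbitMin h x → Reaches h x y → x ≤ᶠ y
OrbitMin⇒least h {x} min r = let (k , e) = Reaches-bounded h r in subst (x ≤ᶠ_) e (min k)

least⇒OrbitMin : (h : Fin N → Fin N) {x : Fin N} → (∀ y → Reaches h x y → x ≤ᶠ y) → OrbitMin h x
least⇒OrbitMin h least k = least _ (toℕ k , refl)

OrbitMin-unique : {h : Fin N → Fin N} → Injective _≡_ _≡_ h → {x y : Fin N} →
                  OrbitMin h x → OrbitMin h y → Reaches h x y → x ≡ y
OrbitMin-unique {h = h} h-inj minx miny r =
  Fin.≤-antisym (OrbitMin⇒least h minx r) (OrbitMin⇒least h miny (Reaches-sym h-inj r))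

fixed⇒OrbitMin : (h : Fin N → Fin N) {x : Fin N} → h x ≡ x → OrbitMin h x
fixed⇒OrbitMin h hx≡x k = Fin.≤-reflexive (sym (iter-fixed h hx≡x (toℕ k)))

least : {P : Pred (Fin N) 0ℓ} → Decidable P → ∀ {y} → P y →
        ∃ λ x → P x × (∀ z → P z → x ≤ᶠ z)
least {N} {P} P? {y} = WF.All.wfRec Fin.<-wellFounded 0ℓ (λ y → P y → Least) search y
  where
  Least : Set
  Least = ∃ λ x → P x × (∀ z → P z → x ≤ᶠ z)

  search : ∀ y → (∀ {z} → z <ᶠ y → P z → Least) → P y → Least
  search y below Py with Fin.any? (λ z → z Fin.<? y ×-dec P? z)
  ... | yes (z , z<y , Pz) = below z<y Pz
  ... | no  nothing<y      = y , Py , λ z Pz → ≮⇒≥ (λ z<y → nothing<y (z , z<y , Pz))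

-- Counting elements of Fin N

count : {P : Pred (Fin N) 0ℓ} → Decidable P → ℕ
count {N} P? = length (filter P? (allFin N))

count-cong : {P Q : Pred (Fin N) 0ℓ} (P? : Decidable P) (Q? : Decidable Q) → P ≐ Q →
             count P? ≡ count Q?
count-cong P? Q? P≐Q = cong length (filter-≐ P? Q? P≐Q (allFin _))

module _ {P : Pred (Fin N) 0ℓ} (P? : Decidable P) (c : Fin N) where

  P∖c? : Decidable (λ x → P x × x ≢ c)
  P∖c? x = P? x ×-dec ¬? (x Fin.≟ c)

  filter-∖-absent : ∀ {xs} → All.All (c ≢_) xs → filter P∖c? xs ≡ filter P? xs
  filter-∖-absent []                     = refl
  filter-∖-absent {x ∷ xs} (c≢x ∷ c∉xs) = step (P? x)
    where
    step : Dec (P x) → filter P∖c? (x ∷ xs) ≡ filter P? (x ∷ xs)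
    step (yes Px) = begin
      filter P∖c? (x ∷ xs)  ≡⟨ filter-accept P∖c? (Px , c≢x ∘ sym) ⟩
      x ∷ filter P∖c? xs    ≡⟨ cong (x ∷_) (filter-∖-absent c∉xs) ⟩
      x ∷ filter P? xs      ≡⟨ filter-accept P? Px ⟨
      filter P? (x ∷ xs)    ∎
    step (no ¬Px) = begin
      filter P∖c? (x ∷ xs)  ≡⟨ filter-reject P∖c? (¬Px ∘ proj₁) ⟩
      filter P∖c? xs        ≡⟨ filter-∖-absent c∉xs ⟩
      filter P? xs          ≡⟨ filter-reject P? ¬Px ⟨
      filter P? (x ∷ xs)    ∎

  length-filter-∖ : ∀ {xs} → Unique xs → c ∈ xs → P c →
                    length (filter P? xs) ≡ suc (length (filter P∖c? xs))
  length-filter-∖ {_ ∷ xs} (c∉xs ∷ _) (here refl) Pc = begin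
    length (filter P? (c ∷ xs))     ≡⟨ cong length (filter-accept P? Pc) ⟩
    suc (length (filter P? xs))     ≡⟨ cong (suc ∘ length) (filter-∖-absent c∉xs) ⟨
    suc (length (filter P∖c? xs))   ≡⟨ cong (suc ∘ length) (filter-reject P∖c? (λ (_ , c≢c) → c≢c refl)) ⟨
    suc (length (filter P∖c? (c ∷ xs))) ∎
  length-filter-∖ {x ∷ xs} (x∉xs ∷ unique) (there c∈xs) Pc = step (P? x)
    where
    x≢c : x ≢ c
    x≢c = All.lookup x∉xs c∈xs

    step : Dec (P x) → length (filter P? (x ∷ xs)) ≡ suc (length (filter P∖c? (x ∷ xs)))
    step (yes Px) = begin
      length (filter P? (x ∷ xs))              ≡⟨ cong length (filter-accept P? Px) ⟩
      suc (length (filter P? xs))              ≡⟨ cong suc (length-filter-∖ unique c∈xs Pc) ⟩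
      suc (suc (length (filter P∖c? xs)))      ≡⟨ cong (suc ∘ length) (filter-accept P∖c? (Px , x≢c)) ⟨
      suc (length (filter P∖c? (x ∷ xs)))      ∎
    step (no ¬Px) = begin
      length (filter P? (x ∷ xs))              ≡⟨ cong length (filter-reject P? ¬Px) ⟩
      length (filter P? xs)                    ≡⟨ length-filter-∖ unique c∈xs Pc ⟩
      suc (length (filter P∖c? xs))            ≡⟨ cong (suc ∘ length) (filter-reject P∖c? (¬Px ∘ proj₁)) ⟨
      suc (length (filter P∖c? (x ∷ xs)))      ∎

  count-remove : P c → count P? ≡ suc (count P∖c?)
  count-remove = length-filter-∖ (allFin⁺ N) (∈-allFin c)

cyclesOn-remove-fixed : {S : Pred (Fin N) 0ℓ} (S? : Decidable S) (h : Fin N → Fin N) {f : Fin N} →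
  h f ≡ f → S f →
  cyclesOn S S? h ≡ suc (cyclesOn (λ x → x ≢ f × S x) (λ x → ¬? (x Fin.≟ f) ×-dec S? x) h)
cyclesOn-remove-fixed {S = S} S? h {f} hf≡f Sf = begin
  count Cycle?                   ≡⟨ count-remove Cycle? f (Sf , fixed⇒OrbitMin h hf≡f) ⟩
  suc (count (P∖c? Cycle? f))    ≡⟨ cong suc (count-cong (P∖c? Cycle? f) Cycle∖f?
                                      ( (λ ((Sx , min) , x≢f) → (x≢f , Sx) , min)
                                      , (λ ((x≢f , Sx) , min) → (Sx , min) , x≢f))) ⟩
  suc (count Cycle∖f?)           ∎
  where
  Cycle? : Decidable (λ x → S x × OrbitMin h x)
  Cycle? x = S? x ×-dec orbitMin? h x

  Cycle∖f? : Decidable (λ x → (x ≢ f × S x) × OrbitMin h x)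
  Cycle∖f? x = (¬? (x Fin.≟ f) ×-dec S? x) ×-dec orbitMin? h x

-- Splicing a point out of its cycle

module Splice {N : ℕ} (τ : Fin N → Fin N) (τ-injective : Injective _≡_ _≡_ τ)
              (s : Fin N) (τs≢s : τ s ≢ s) (g : Fin N → Fin N)
              (g-skip : ∀ x → τ x ≡ s → g x ≡ τ (τ x))
              (g-step : ∀ x → τ x ≢ s → g x ≡ τ x) where

  g≢s : ∀ x → g x ≢ s
  g≢s x gx≡s with τ x Fin.≟ s
  ... | yes τx≡s = τs≢s (trans (sym (trans (g-skip x τx≡s) (cong τ τx≡s))) gx≡s)
  ... | no  τx≢s = τx≢s (trans (sym (g-step x τx≢s)) gx≡s)

  Reaches-g⇒τ : ∀ {x y} → Reaches g x y → Reaches τ x y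
  Reaches-g⇒τ {x} (k , refl) = reached k
    where
    reached : ∀ k → Reaches τ x (iter g k x)
    reached zero = 0 , refl
    reached (suc k) with reached k | τ (iter g k x) Fin.≟ s
    ... | m , e | yes τy≡s = suc (suc m) , trans (cong (τ ∘ τ) e) (sym (g-skip _ τy≡s))
    ... | m , e | no  τy≢s = suc m , trans (cong τ e) (sym (g-step _ τy≢s))

  Reaches-g-≢s : ∀ {x y} → x ≢ s → Reaches g x y → y ≢ s
  Reaches-g-≢s x≢s (zero  , refl) = x≢s
  Reaches-g-≢s x≢s (suc k , refl) = g≢s _

  iter-τ-reached : ∀ {x} → x ≢ s → ∀ m → iter τ m x ≢ s → Reaches g x (iter τ m x)
  iter-τ-reached {x} x≢s m = proj₁ (consecutive m)
    where
    Reached : ℕ → Set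
    Reached m = iter τ m x ≢ s → Reaches g x (iter τ m x)

    next : ∀ m → Reached m → Reached (suc m) → Reached (suc (suc m))
    next m reached₀ reached₁ τ²y≢s with iter τ (suc m) x Fin.≟ s
    ... | no  τy≢s = Reaches-step g (reached₁ τy≢s) (g-step _ τ²y≢s)
    ... | yes τy≡s = Reaches-step g (reached₀ (λ y≡s → τs≢s (trans (cong τ (sym y≡s)) τy≡s)))
                                    (g-skip _ τy≡s)

    consecutive : ∀ m → Reached m × Reached (suc m)
    consecutive zero    = (λ _ → 0 , refl) , (λ τx≢s → 1 , g-step x τx≢s)
    consecutive (suc m) = let (reached₀ , reached₁) = consecutive m in reached₁ , next m reached₀ reached₁

  Reaches-τ⇒g : ∀ {x y} → x ≢ s → Reaches τ x y → y ≢ s → Reaches g x y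
  Reaches-τ⇒g x≢s (m , refl) = iter-τ-reached x≢s m

  OrbitMin-g⇒least : ∀ {x y} → x ≢ s → OrbitMin g x → Reaches τ x y → y ≢ s → x ≤ᶠ y
  OrbitMin-g⇒least x≢s min r y≢s = OrbitMin⇒least g min (Reaches-τ⇒g x≢s r y≢s)

  least⇒OrbitMin-g : ∀ {x} → x ≢ s → (∀ y → Reaches τ x y → y ≢ s → x ≤ᶠ y) → OrbitMin g x
  least⇒OrbitMin-g x≢s least = least⇒OrbitMin g λ y r → least y (Reaches-g⇒τ r) (Reaches-g-≢s x≢s r)

  OrbitMin-τ⇒g : ∀ {x} → x ≢ s → OrbitMin τ x → OrbitMin g x
  OrbitMin-τ⇒g x≢s min = least⇒OrbitMin-g x≢s λ y r _ → OrbitMin⇒least τ min r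

  OrbitMin-g⇒τ : ∀ {x} → x ≢ s → OrbitMin g x → (Reaches τ x s → x ≤ᶠ s) → OrbitMin τ x
  OrbitMin-g⇒τ {x} x≢s min x≤s = least⇒OrbitMin τ bound
    where
    bound : ∀ y → Reaches τ x y → x ≤ᶠ y
    bound y r with y Fin.≟ s
    ... | yes refl = x≤s r
    ... | no  y≢s  = OrbitMin-g⇒least x≢s min r y≢s

  module _ (s-not-min : ¬ OrbitMin τ s) where

    below-s : ∃ λ y → Reaches τ s y × y <ᶠ s
    below-s =
      let (k , s≰) = Fin.¬∀⟶∃¬ N _ (λ k → s Fin.≤? iter τ (toℕ k) s) s-not-min
      in iter τ (toℕ k) s , (toℕ k , refl) , ≰⇒> s≰

    OrbitMin-g⇒τ-s-not-min : ∀ {x} → x ≢ s → OrbitMin g x → OrbitMin τ x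
    OrbitMin-g⇒τ-s-not-min x≢s min = OrbitMin-g⇒τ x≢s min λ x⇝s →
      let (y , s⇝y , y<s) = below-s
      in <⇒≤ (≤-<-trans (OrbitMin-g⇒least x≢s min (Reaches-trans τ x⇝s s⇝y) (Fin.<⇒≢ y<s)) y<s)

    cycles-splice-s-not-min : cyclesOn (λ x → x ≢ s) (λ x → ¬? (x Fin.≟ s)) g ≡ cycles τ
    cycles-splice-s-not-min = count-cong (λ x → ¬? (x Fin.≟ s) ×-dec orbitMin? g x)
                                     (λ x → everything? x ×-dec orbitMin? τ x)
      ( (λ (x≢s , min) → tt , OrbitMin-g⇒τ-s-not-min x≢s min)
      , (λ (_ , min) → let x≢s = λ x≡s → s-not-min (subst (OrbitMin τ) x≡s min)
                       in x≢s , OrbitMin-τ⇒g x≢s min))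

  module _ (s-min : OrbitMin τ s) where

    private
      next-least : ∃ λ m → (m ≢ s × Reaches τ s m) × (∀ z → z ≢ s × Reaches τ s z → m ≤ᶠ z)
      next-least = least (λ y → ¬? (y Fin.≟ s) ×-dec reaches? τ s y) (τs≢s , 1 , refl)

    m : Fin N
    m = proj₁ next-least

    m≢s : m ≢ s
    m≢s = proj₁ (proj₁ (proj₂ next-least))

    s⇝m : Reaches τ s m
    s⇝m = proj₂ (proj₁ (proj₂ next-least))

    m-least : ∀ z → z ≢ s → Reaches τ s z → m ≤ᶠ z
    m-least z z≢s s⇝z = proj₂ (proj₂ next-least) z (z≢s , s⇝z)

    m-not-OrbitMin-τ : ¬ OrbitMin τ m
    m-not-OrbitMin-τ min = m≢s (sym (OrbitMin-unique τ-injective s-min min s⇝m))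

    m-OrbitMin-g : OrbitMin g m
    m-OrbitMin-g = least⇒OrbitMin-g m≢s λ y m⇝y y≢s → m-least y y≢s (Reaches-trans τ s⇝m m⇝y)

    OrbitMin-g⇒τ-s-min : ∀ {x} → x ≢ s → x ≢ m → OrbitMin g x → OrbitMin τ x
    OrbitMin-g⇒τ-s-min {x} x≢s x≢m min = OrbitMin-g⇒τ x≢s min λ x⇝s → ⊥-elim (x≢m (Fin.≤-antisym
      (OrbitMin-g⇒least x≢s min (Reaches-trans τ x⇝s s⇝m) m≢s)
      (m-least x x≢s (Reaches-sym τ-injective x⇝s))))

    cycles-splice-s-min : cyclesOn (λ x → x ≢ s) (λ x → ¬? (x Fin.≟ s)) g ≡ cycles τ
    cycles-splice-s-min = begin
      count Off-s?                  ≡⟨ count-remove Off-s? m (m≢s , m-OrbitMin-g) ⟩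
      suc (count (P∖c? Off-s? m))   ≡⟨ cong suc (count-cong (P∖c? Off-s? m) (P∖c? Cycle? s)
        ( (λ ((x≢s , min) , x≢m) → (tt , OrbitMin-g⇒τ-s-min x≢s x≢m min) , x≢s)
        , (λ ((_ , min) , x≢s) → (x≢s , OrbitMin-τ⇒g x≢s min)
                                , λ x≡m → m-not-OrbitMin-τ (subst (OrbitMin τ) x≡m min)))) ⟩
      suc (count (P∖c? Cycle? s))    ≡⟨ count-remove Cycle? s (tt , s-min) ⟨
      count Cycle?                   ∎
      where
      Off-s? : Decidable (λ x → x ≢ s × OrbitMin g x)
      Off-s? x = ¬? (x Fin.≟ s) ×-dec orbitMin? g x
      Cycle? : Decidable (λ x → Everything x × OrbitMin τ x)
      Cycle? x = everything? x ×-dec orbitMin? τ x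

  cycles-splice : cyclesOn (λ x → x ≢ s) (λ x → ¬? (x Fin.≟ s)) g ≡ cycles τ
  cycles-splice with orbitMin? τ s
  ... | yes s-min     = cycles-splice-s-min s-min
  ... | no  s-not-min = cycles-splice-s-not-min s-not-min

perm-injective : (π : Permutation′ N) → Injective _≡_ _≡_ (π ⟨$⟩ʳ_)
perm-injective π = Injection.injective (↔⇒↣ π)

two-points-cannot-cover : 2 < N → (u v : Fin N) → ¬ (∀ y → y ≡ u ⊎ y ≡ v)
two-points-cannot-cover (s≤s (s≤s (s≤s _))) u v cover
  with cover 0F | cover 1F | cover 2F
... | inj₁ refl | inj₁ ()   | _
... | inj₂ refl | inj₂ ()   | _
... | inj₁ refl | inj₂ refl | inj₁ ()
... | inj₁ refl | inj₂ refl | inj₂ ()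
... | inj₂ refl | inj₁ refl | inj₁ ()
... | inj₂ refl | inj₁ refl | inj₂ ()

full-cycle-σ²≢id : 2 < N → (σ : Permutation′ N) → IsFullCycle σ → ∀ f → σ ⟨$⟩ʳ (σ ⟨$⟩ʳ f) ≢ f
full-cycle-σ²≢id 2<N σ full f σ²f≡f = two-points-cannot-cover 2<N f (σ ⟨$⟩ʳ f) λ y →
  let (k , σᵏf≡y) = full f y in subst (λ z → z ≡ f ⊎ z ≡ σ ⟨$⟩ʳ f) σᵏf≡y (orbit k)
  where
  orbit : ∀ k → iter (σ ⟨$⟩ʳ_) k f ≡ f ⊎ iter (σ ⟨$⟩ʳ_) k f ≡ σ ⟨$⟩ʳ f
  orbit zero = inj₁ refl
  orbit (suc k) with orbit k
  ... | inj₁ σᵏf≡f  = inj₂ (cong (σ ⟨$⟩ʳ_) σᵏf≡f)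
  ... | inj₂ σᵏf≡σf = inj₁ (trans (cong (σ ⟨$⟩ʳ_) σᵏf≡σf) σ²f≡f)

σ̂-skip : (σ : Permutation′ N) {f x : Fin N} → σ ⟨$⟩ʳ x ≡ f → σ̂ σ f x ≡ σ ⟨$⟩ʳ (σ ⟨$⟩ʳ (σ ⟨$⟩ʳ x))
σ̂-skip σ {f} {x} σx≡f with σ ⟨$⟩ʳ x Fin.≟ f
... | yes _    = refl
... | no σx≢f = ⊥-elim (σx≢f σx≡f)

σ̂-step : (σ : Permutation′ N) {f x : Fin N} → σ ⟨$⟩ʳ x ≢ f → σ̂ σ f x ≡ σ ⟨$⟩ʳ x
σ̂-step σ {f} {x} σx≢f with σ ⟨$⟩ʳ x Fin.≟ f
... | yes σx≡f = ⊥-elim (σx≢f σx≡f)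
... | no _     = refl

ρσ-injective : (ρ σ : Permutation′ N) → Injective _≡_ _≡_ (ρ ∘ₚ σ)
ρσ-injective ρ σ = perm-injective σ ∘ perm-injective ρ

module FixedPoint {N : ℕ} (σ ρ : Permutation′ N)
                  (ρ-involutive : ∀ x → ρ ⟨$⟩ʳ (ρ ⟨$⟩ʳ x) ≡ x) (ρ-fixed-point-free : ∀ x → ρ ⟨$⟩ʳ x ≢ x)
                  (f : Fin N) (ρσf≡f : (ρ ∘ₚ σ) f ≡ f) where

  ρσ̂ : Fin N → Fin N
  ρσ̂ k = ρ̂ ρ (σ̂ σ f k)

  ρf≡σf : ρ ⟨$⟩ʳ f ≡ σ ⟨$⟩ʳ f
  ρf≡σf = trans (cong (ρ ⟨$⟩ʳ_) (sym ρσf≡f)) (ρ-involutive (σ ⟨$⟩ʳ f))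

  f≢σf : f ≢ σ ⟨$⟩ʳ f
  f≢σf f≡σf = ρ-fixed-point-free f (trans ρf≡σf (sym f≡σf))

  ρσ≡σf⇒σ≡f : ∀ {x} → (ρ ∘ₚ σ) x ≡ σ ⟨$⟩ʳ f → σ ⟨$⟩ʳ x ≡ f
  ρσ≡σf⇒σ≡f ρσx≡σf = perm-injective ρ (trans ρσx≡σf (sym ρf≡σf))

  ρσ-moves-σf : 2 < N → IsFullCycle σ → (ρ ∘ₚ σ) (σ ⟨$⟩ʳ f) ≢ σ ⟨$⟩ʳ f
  ρσ-moves-σf 2<N σ-full = full-cycle-σ²≢id 2<N σ σ-full f ∘ ρσ≡σf⇒σ≡f

  ρσ̂-skip : ∀ x → (ρ ∘ₚ σ) x ≡ σ ⟨$⟩ʳ f → ρσ̂ x ≡ (ρ ∘ₚ σ) ((ρ ∘ₚ σ) x)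
  ρσ̂-skip x ρσx≡σf = begin
    ρ ⟨$⟩ʳ (σ̂ σ f x)                          ≡⟨ cong (ρ ⟨$⟩ʳ_) (σ̂-skip σ (ρσ≡σf⇒σ≡f ρσx≡σf)) ⟩
    ρ ⟨$⟩ʳ (σ ⟨$⟩ʳ (σ ⟨$⟩ʳ (σ ⟨$⟩ʳ x)))       ≡⟨ cong (λ y → ρ ⟨$⟩ʳ (σ ⟨$⟩ʳ (σ ⟨$⟩ʳ y))) (ρσ≡σf⇒σ≡f ρσx≡σf) ⟩
    (ρ ∘ₚ σ) (σ ⟨$⟩ʳ f)                       ≡⟨ cong (ρ ∘ₚ σ) ρσx≡σf ⟨
    (ρ ∘ₚ σ) ((ρ ∘ₚ σ) x)                     ∎

  ρσ̂-step : ∀ x → (ρ ∘ₚ σ) x ≢ σ ⟨$⟩ʳ f → ρσ̂ x ≡ (ρ ∘ₚ σ) x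
  ρσ̂-step x ρσx≢σf = cong (ρ ⟨$⟩ʳ_) (σ̂-step σ λ σx≡f → ρσx≢σf (trans (cong (ρ ⟨$⟩ʳ_) σx≡f) ρf≡σf))

  ρσ̂-fixes-f : ρσ̂ f ≡ f
  ρσ̂-fixes-f = trans (ρσ̂-step f (λ ρσf≡σf → f≢σf (trans (sym ρσf≡f) ρσf≡σf))) ρσf≡f

lemma4p10 : (n : ℕ) → 1 < n → (σ ρ : Permutation′ (2 * n)) →
              IsFullCycle σ → IsFixedPointFreeInvolution ρ →
              cycles (ρ ∘ₚ σ) ≡ n + 1 →
              (f : Fin (2 * n)) → (ρ ∘ₚ σ) f ≡ f →
              cyclesOn (Rest σ f) (rest? σ f) (λ k → ρ̂ ρ (σ̂ σ f k)) ≡ n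
lemma4p10 n 1<n σ ρ σ-full (ρ-involutive , ρ-fixed-point-free) cycles≡n+1 f ρσf≡f = suc-injective (begin
  suc (cyclesOn (Rest σ f) (rest? σ f) ρσ̂)  ≡⟨ cyclesOn-remove-fixed σf≢? ρσ̂ ρσ̂-fixes-f f≢σf ⟨
  cyclesOn (_≢ σ ⟨$⟩ʳ f) σf≢? ρσ̂            ≡⟨ Splice.cycles-splice (ρ ∘ₚ σ) (ρσ-injective ρ σ) (σ ⟨$⟩ʳ f)
                                                 (ρσ-moves-σf 2<2n σ-full) ρσ̂ ρσ̂-skip ρσ̂-step ⟩
  cycles (ρ ∘ₚ σ)                           ≡⟨ cycles≡n+1 ⟩
  n + 1                                     ≡⟨ +-comm n 1 ⟩
  suc n                                     ∎)
  where
  open FixedPoint σ ρ ρ-involutive ρ-fixed-point-free f ρσf≡f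

  σf≢? : Decidable (_≢ σ ⟨$⟩ʳ f)
  σf≢? x = ¬? (x Fin.≟ σ ⟨$⟩ʳ f)

  2<2n : 2 < 2 * n
  2<2n = <-≤-trans (s≤s (s≤s (s≤s z≤n))) (*-monoʳ-≤ 2 1<n)
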